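{- Setup: - Let $G$ be a graph containing a vertex $B$. Let $\tilde G$ be obtained from $G$ by adding a new vertex $A$ and a new edge $AB$. - Let $\tilde h,\tilde g\colon V(\tilde G)\to\mathbb N$, and put $h=\tilde h$, $g=\tilde g$ (where $h,g$ restricted to $V(G)$ give the game on $G$; we write $h(A)=\tilde h(A)$, $g(A)=\tilde g(A)$). - Let $w_A,w_B$ be natural numbers with $g(A)\le w_A\le h(A)$ and $g(B)\le w_B\le h(B)$. - Suppose: (i) the game with hint $\langle G,h|_{V(G)},g|_{V(G)},B,w_B\rangle$ is winning; (ii) $h(B)$ divides $w_B\cdot h(A)$; (iii) $w_Aw_B\ge (w_A-g(A))h(B)$. Conclusion: the game with hint $\langle\tilde G,\tilde h,\tilde g,A,w_A\rangle$ is winning.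
   Context: Hat guessing game $\langle G,h,g\rangle$: $G=(V,E)$ is a finite graph and $h,g\colon V\to\mathbb N$. The adversary gives each vertex $v$ a color in $\{0,\dots,h(v)-1\}$. Each vertex sees only its neighbors' colors and names at most $g(v)$ colors via a deterministic strategy fixed in advance. The game is winning if some strategy ensures that for every assignment some vertex names its own color. Game with hint $\langle G,h,g,B,w_B\rangle$, for a vertex $B$ and a natural number $w_B\le h(B)$: the game $\langle G,h,g\rangle$ modified as follows. In addition, sage $B$ (and only $B$) is told by the adversary a set of $w_B$ cyclically consecutive residues $\{x,x+1,\dots,x+w_B-1\}\bmod h(B)$ that contains the color of $B$'s hat. $B$'s list may depend on this set as well as on his neighbors' colors. The game is winning if there is a strategy that guarantees a correct guess for every hat assignment and every admissible hint. -}

module Defs where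

open import Data.Nat using (ℕ; zero; suc; _+_; _*_; _≤_)
open import Data.Fin using (Fin; zero; suc; toℕ; _≟_)
open import Data.Bool using (Bool; true; false)
open import Data.List using (List; length)
open import Data.List.Membership.Propositional using (_∈_)
open import Data.Product using (Σ; ∃; ∃-syntax; _×_; _,_)
open import Relation.Nullary using (¬_)
open import Relation.Nullary.Decidable using (⌊_⌋)
open import Relation.Binary.PropositionalEquality using (_≡_)

record Graph (n : ℕ) : Set where
  field
    adj   : Fin n → Fin n → Bool
    sym   : ∀ u v → adj u v ≡ adj v u
    irrfl : ∀ v → adj v v ≡ false
open Graph public

Coloring : {n : ℕ} → (Fin n → ℕ) → Set
Coloring {n} h = (v : Fin n) → Fin (h v)

Admissible : {n : ℕ} (h : Fin n → ℕ) (B : Fin n) (w : ℕ) →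
             Coloring h → Fin (h B) → Set
Admissible h B w c x =
  ∃[ i ] ∃[ k ] (i Data.Nat.< w × toℕ x + i ≡ toℕ (c B) + k * h B)

record HintStrategy {n : ℕ} (G : Graph n) (h g : Fin n → ℕ) (B : Fin n) : Set where
  field
    guess     : (v : Fin n) → Fin (h B) → Coloring h → List (Fin (h v))
    local     : ∀ v x (c c' : Coloring h) →
                (∀ u → adj G v u ≡ true → c u ≡ c' u) →
                guess v x c ≡ guess v x c'
    hintOnlyB : ∀ v → ¬ (v ≡ B) → ∀ x x' (c : Coloring h) →
                guess v x c ≡ guess v x' c
    bounded   : ∀ v x c → length (guess v x c) ≤ g v
open HintStrategy public

WinningWithHint : {n : ℕ} (G : Graph n) (h g : Fin n → ℕ) (B : Fin n) (w : ℕ) → Set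
WinningWithHint G h g B w =
  Σ (HintStrategy G h g B) λ S →
    ∀ (c : Coloring h) (x : Fin (h B)) → Admissible h B w c x →
      ∃[ v ] (c v ∈ guess S v x c)

-- G̃: add a new vertex A (= zero) to G, adjacent only to B (old vertex v
-- becomes suc v).
pendAdj : {n : ℕ} → Graph n → Fin n → Fin (suc n) → Fin (suc n) → Bool
pendAdj G B zero    zero    = false
pendAdj G B zero    (suc u) = ⌊ u ≟ B ⌋
pendAdj G B (suc v) zero    = ⌊ v ≟ B ⌋
pendAdj G B (suc v) (suc u) = adj G v u

pendSym : {n : ℕ} (G : Graph n) (B : Fin n) → ∀ u v → pendAdj G B u v ≡ pendAdj G B v u
pendSym G B zero    zero    = Relation.Binary.PropositionalEquality.refl
pendSym G B zero    (suc u) = Relation.Binary.PropositionalEquality.refl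
pendSym G B (suc v) zero    = Relation.Binary.PropositionalEquality.refl
pendSym G B (suc v) (suc u) = sym G v u

pendIrr : {n : ℕ} (G : Graph n) (B : Fin n) → ∀ v → pendAdj G B v v ≡ false
pendIrr G B zero    = Relation.Binary.PropositionalEquality.refl
pendIrr G B (suc v) = irrfl G v

addPendant : {n : ℕ} → Graph n → Fin n → Graph (suc n)
addPendant G B = record { adj = pendAdj G B ; sym = pendSym G B ; irrfl = pendIrr G B }

-- B plays its winning strategy for G as if it had been told the window of width wB starting at
-- c(A)·wB (mod hB); since hB ∣ wB·hA this window depends only on c(A) mod hA.  For a candidate
-- colour j of A (x ≤ j < x + wA) the window is the block [j·wB, (j+1)·wB) read mod hB, and if c(B)
-- lies in the block of the true colour, B guesses right.  A knows x and sees c(B), so it names exactly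
-- the candidates whose block misses c(B).  The wA blocks tile an interval of length wA·wB, which
-- contains at least ⌊wA·wB/hB⌋ ≥ wA − g(A) points ≡ c(B), and as wB ≤ hB each block contains at most
-- one of them; hence at most g(A) blocks miss.
module Submission where

open import Defs
open import Data.Nat using (ℕ; zero; suc; _+_; _*_; _∸_; _≤_; _<_; NonZero; _≤?_; pred)
open import Data.Nat.Divisibility using (_∣_; divides)
open import Data.Fin using (Fin; zero; suc; toℕ; _≟_)
open import Function using (_∘_)

open import Algebra.Properties.CommutativeSemigroup as +-Semigroup using ()
open import Data.Bool using (true)
open import Data.Fin.Properties using (nonZeroIndex; toℕ-fromℕ<; toℕ-injective; toℕ<n)
open import Data.List using (List; []; _∷_; length; map)
open import Data.List.Membership.Propositional using (_∈_)
open import Data.List.Membership.Propositional.Properties using (∈-map⁺)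
open import Data.List.Properties using (length-map)
open import Data.List.Relation.Unary.Any using (here; there)
open import Data.Nat.DivMod using (_%_; _/_; _mod_; [m+n]%n≡m%n; [m+kn]%n≡m%n; m%n<n; m≡m%n+[m/n]*n; m<n⇒m%n≡m)
open import Data.Nat.Properties hiding (_≟_)
open import Data.Nat using () renaming (_≟_ to _≟ℕ_)
open import Data.Nat.Tactic.RingSolver using (solve-∀)
open import Data.Product using (∃-syntax; _×_; _,_)
open import Data.Sum using (_⊎_; inj₁; inj₂; map₂)
open import Relation.Nullary using (yes; no; ¬_; contradiction)
open import Relation.Nullary.Decidable using (isYes≗does; dec-true)
open import Relation.Binary.PropositionalEquality using (_≡_; refl; cong; trans; subst; module ≡-Reasoning)
  renaming (sym to ≡-sym)

open +-Semigroup +-commutativeSemigroup using (interchange; xy∙z≈xz∙y)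

[m%n+k]%n≡[m+k]%n : ∀ m k n .{{_ : NonZero n}} → (m % n + k) % n ≡ (m + k) % n
[m%n+k]%n≡[m+k]%n m k n = begin
  (m % n + k) % n                 ≡⟨ [m+kn]%n≡m%n (m % n + k) (m / n) n ⟨
  (m % n + k + m / n * n) % n     ≡⟨ cong (_% n) (xy∙z≈xz∙y (m % n) k (m / n * n)) ⟩
  (m % n + m / n * n + k) % n     ≡⟨ cong (λ z → (z + k) % n) (m≡m%n+[m/n]*n m n) ⟨
  (m + k) % n                     ∎
  where open ≡-Reasoning

[m*w+e]%d≡[n*w+e]%d : ∀ {m n k h w d} e .{{_ : NonZero d}} → d ∣ w * h → m ≡ n + k * h →
                      (m * w + e) % d ≡ (n * w + e) % d
[m*w+e]%d≡[n*w+e]%d {m} {n} {k} {h} {w} {d} e (divides q w*h≡q*d) refl = begin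
  ((n + k * h) * w + e) % d     ≡⟨ cong (_% d) (expand n k h w e) ⟩
  (n * w + e + k * (w * h)) % d ≡⟨ cong (λ z → (n * w + e + k * z) % d) w*h≡q*d ⟩
  (n * w + e + k * (q * d)) % d ≡⟨ cong (λ z → (n * w + e + z) % d) (*-assoc k q d) ⟨
  (n * w + e + k * q * d) % d   ≡⟨ [m+kn]%n≡m%n (n * w + e) (k * q) d ⟩
  (n * w + e) % d               ∎
  where
  open ≡-Reasoning
  expand : ∀ n k h w e → (n + k * h) * w + e ≡ n * w + e + k * (w * h)
  expand = solve-∀

n≡y+km⇒n-mod-m≡y : ∀ {m n k} (y : Fin m) → n ≡ toℕ y + k * m →
                   (n mod m) {{nonZeroIndex y}} ≡ y
n≡y+km⇒n-mod-m≡y {m} {n} {k} y refl = toℕ-injective (begin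
  toℕ (n mod m)       ≡⟨ toℕ-fromℕ< _ ⟩
  (toℕ y + k * m) % m ≡⟨ [m+kn]%n≡m%n (toℕ y) k m ⟩
  toℕ y % m           ≡⟨ m<n⇒m%n≡m (toℕ<n y) ⟩
  toℕ y               ∎)
  where
  open ≡-Reasoning
  instance _ = nonZeroIndex y

admissible-% : ∀ {n} {h : Fin n → ℕ} {B w} {c : Coloring h} {x : Fin (h B)} {e} .{{_ : NonZero (h B)}} →
               e < w → (toℕ x + e) % h B ≡ toℕ (c B) % h B → Admissible h B w c x
admissible-% {h = h} {B} {c = c} {x} {e} e<w x+e≡cB = e , (toℕ x + e) / h B , e<w , (begin
  toℕ x + e                                  ≡⟨ m≡m%n+[m/n]*n (toℕ x + e) (h B) ⟩
  (toℕ x + e) % h B + (toℕ x + e) / h B * h B ≡⟨ cong (_+ (toℕ x + e) / h B * h B) x+e≡cB ⟩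
  toℕ (c B) % h B + (toℕ x + e) / h B * h B   ≡⟨ cong (_+ (toℕ x + e) / h B * h B) (m<n⇒m%n≡m (toℕ<n (c B))) ⟩
  toℕ (c B) + (toℕ x + e) / h B * h B         ∎)
  where open ≡-Reasoning

-- Block j of the line is [j·w, (j+1)·w); d is the distance from the start of the current block i
-- to the next point of a fixed residue class modulo h, so block i misses the class iff w ≤ d.
module Blocks (w h : ℕ) (w≤h : w ≤ h) where

  missedBlocks : (m i d : ℕ) → List ℕ
  missedBlocks zero    i d = []
  missedBlocks (suc m) i d with w ≤? d
  ... | yes _ = i ∷ missedBlocks m (suc i) (d ∸ w)
  ... | no  _ = missedBlocks m (suc i) (d + (h ∸ w))

  -- e is the distance left after the last block.
  missedBlocks-length : ∀ m i d → ∃[ e ] (d + m * h ≡ m * w + e + length (missedBlocks m i d) * h)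
  missedBlocks-length zero    i d = d , refl
  missedBlocks-length (suc m) i d with w ≤? d
  ... | yes w≤d with missedBlocks-length m (suc i) (d ∸ w)
  ...   | e , eq = e , (begin
      d + (h + m * h)                 ≡⟨ cong (_+ (h + m * h)) (m+[n∸m]≡n w≤d) ⟨
      w + (d ∸ w) + (h + m * h)       ≡⟨ interchange w (d ∸ w) h (m * h) ⟩
      w + h + ((d ∸ w) + m * h)       ≡⟨ cong (w + h +_) eq ⟩
      w + h + (m * w + e + L * h)     ≡⟨ regroup w h (m * w) e (L * h) ⟩
      w + m * w + e + (h + L * h)     ∎)
    where
    open ≡-Reasoning
    L = length (missedBlocks m (suc i) (d ∸ w))
    regroup : ∀ a b c e f → a + b + (c + e + f) ≡ a + c + e + (b + f)
    regroup = solve-∀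
  missedBlocks-length (suc m) i d | no _ with missedBlocks-length m (suc i) (d + (h ∸ w))
  ...   | e , eq = e , (begin
      d + (h + m * h)                 ≡⟨ cong (λ z → d + (z + m * h)) (m∸n+n≡m w≤h) ⟨
      d + (h ∸ w + w + m * h)         ≡⟨ regroup d (h ∸ w) w (m * h) ⟩
      w + (d + (h ∸ w) + m * h)       ≡⟨ cong (w +_) eq ⟩
      w + (m * w + e + L * h)         ≡⟨ reassociate w (m * w) e (L * h) ⟩
      w + m * w + e + L * h           ∎)
    where
    open ≡-Reasoning
    L = length (missedBlocks m (suc i) (d + (h ∸ w)))
    regroup : ∀ d s w f → d + (s + w + f) ≡ w + (d + s + f)
    regroup = solve-∀
    reassociate : ∀ a b c f → a + (b + c + f) ≡ a + b + c + f
    reassociate = solve-∀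

  length-missedBlocks≤ : ∀ {m g d} i → d < h → g ≤ m → (m ∸ g) * h ≤ m * w →
                         length (missedBlocks m i d) ≤ g
  length-missedBlocks≤ {m} {g} {d} i d<h g≤m few-misses = +-cancelˡ-≤ (m ∸ g) L g (begin
    m ∸ g + L ≤⟨ ≤-pred (*-cancelʳ-< h _ _ scaled) ⟩
    m         ≡⟨ m∸n+n≡m g≤m ⟨
    m ∸ g + g ∎)
    where
    open ≤-Reasoning
    L = length (missedBlocks m i d)
    scaled : (m ∸ g + L) * h < suc m * h
    scaled with missedBlocks-length m i d
    ... | e , eq = begin-strict
      (m ∸ g + L) * h       ≡⟨ *-distribʳ-+ h (m ∸ g) L ⟩
      (m ∸ g) * h + L * h   ≤⟨ +-monoˡ-≤ (L * h) few-misses ⟩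
      m * w + L * h         ≤⟨ +-monoˡ-≤ (L * h) (m≤m+n (m * w) e) ⟩
      m * w + e + L * h     ≡⟨ eq ⟨
      d + m * h             <⟨ +-monoˡ-< (m * h) d<h ⟩
      h + m * h             ∎

  module _ .{{_ : NonZero h}} (r : ℕ) where

    HitBlock : ℕ → Set
    HitBlock j = ∃[ e ] (e < w × (j * w + e) % h ≡ r % h)

    hit⊎missed : ∀ m i d → (i * w + d) % h ≡ r % h → ∀ {j} → i ≤ j → j < i + m →
                 HitBlock j ⊎ j ∈ missedBlocks m i d
    hit⊎missed zero i d _ i≤j j<i+0 = contradiction (subst (_ <_) (+-identityʳ i) j<i+0) (≤⇒≯ i≤j)
    hit⊎missed (suc m) i d next {j} i≤j j<i+1+m with w ≤? d | i ≟ℕ j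
    ... | yes _   | yes refl = inj₂ (here refl)
    ... | no  w≰d | yes refl = inj₁ (d , ≰⇒> w≰d , next)
    ... | yes w≤d | no  i≢j  =
      map₂ there (hit⊎missed m (suc i) (d ∸ w) (trans (cong (_% h) skip) next) (≤∧≢⇒< i≤j i≢j) j<suc-i+m)
      where
      j<suc-i+m = subst (j <_) (+-suc i m) j<i+1+m
      skip : suc i * w + (d ∸ w) ≡ i * w + d
      skip = begin
        w + i * w + (d ∸ w)   ≡⟨ cong (_+ (d ∸ w)) (+-comm w (i * w)) ⟩
        i * w + w + (d ∸ w)   ≡⟨ +-assoc (i * w) w (d ∸ w) ⟩
        i * w + (w + (d ∸ w)) ≡⟨ cong (i * w +_) (m+[n∸m]≡n w≤d) ⟩
        i * w + d             ∎
        where open ≡-Reasoning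
    ... | no  _   | no  i≢j  =
      hit⊎missed m (suc i) (d + (h ∸ w)) (trans (cong (_% h) wrap) (trans ([m+n]%n≡m%n (i * w + d) h) next))
                 (≤∧≢⇒< i≤j i≢j) (subst (j <_) (+-suc i m) j<i+1+m)
      where
      wrap : suc i * w + (d + (h ∸ w)) ≡ i * w + d + h
      wrap = begin
        w + i * w + (d + (h ∸ w)) ≡⟨ regroup w (i * w) d (h ∸ w) ⟩
        i * w + d + (h ∸ w + w)   ≡⟨ cong (i * w + d +_) (m∸n+n≡m w≤h) ⟩
        i * w + d + h             ∎
        where
        open ≡-Reasoning
        regroup : ∀ a x y z → a + x + (y + z) ≡ x + y + (z + a)
        regroup = solve-∀

    -- (r − t·w) mod h, written without truncated subtraction.
    offset : ℕ → ℕ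
    offset t = (r + t * w * pred h) % h

    offset<h : ∀ t → offset t < h
    offset<h t = m%n<n _ h

    offset-correct : ∀ t → (t * w + offset t) % h ≡ r % h
    offset-correct t = begin
      (t * w + offset t) % h                  ≡⟨ cong (_% h) (+-comm (t * w) (offset t)) ⟩
      (offset t + t * w) % h                  ≡⟨ [m%n+k]%n≡[m+k]%n (r + t * w * pred h) (t * w) h ⟩
      (r + t * w * pred h + t * w) % h        ≡⟨ cong (_% h) (+-assoc r _ (t * w)) ⟩
      (r + (t * w * pred h + t * w)) % h      ≡⟨ cong (λ z → (r + z) % h) (+-comm _ (t * w)) ⟩
      (r + (t * w + t * w * pred h)) % h      ≡⟨ cong (λ z → (r + z) % h) (*-suc (t * w) (pred h)) ⟨
      (r + t * w * suc (pred h)) % h          ≡⟨ cong (λ z → (r + t * w * z) % h) (suc-pred h) ⟩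
      (r + t * w * h) % h                     ≡⟨ [m+kn]%n≡m%n r (t * w) h ⟩
      r % h                                   ∎
      where open ≡-Reasoning

module PendantStrategy {n} (G : Graph n) (B : Fin n) (h g : Fin (suc n) → ℕ) (wA wB : ℕ)
                       (wB≤hB : wB ≤ h (suc B)) (S : HintStrategy G (h ∘ suc) (g ∘ suc) B) where

  hA hB : ℕ
  hA = h zero
  hB = h (suc B)

  open Blocks wB hB wB≤hB

  A∼B : adj (addPendant G B) zero (suc B) ≡ true
  A∼B = trans (isYes≗does (B ≟ B)) (dec-true (B ≟ B) refl)

  hintB : Coloring h → Fin hB
  hintB c = (toℕ (c zero) * wB) mod hB
    where instance _ = nonZeroIndex (c (suc B))

  -- offset (toℕ b) (toℕ x) is the distance from x·wB to the next point ≡ b (mod hB).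
  guessesA : Fin hA → Fin hB → List (Fin hA)
  guessesA x b = map (_mod hA) (missedBlocks wA (toℕ x) (offset (toℕ b) (toℕ x)))
    where
    instance _ = nonZeroIndex x
             _ = nonZeroIndex b

  guesses : (v : Fin (suc n)) → Fin hA → Coloring h → List (Fin (h v))
  guesses zero    x c = guessesA x (c (suc B))
  guesses (suc u) x c = guess S u (hintB c) (c ∘ suc)

  guesses-local : ∀ v x (c c' : Coloring h) → (∀ u → adj (addPendant G B) v u ≡ true → c u ≡ c' u) →
                  guesses v x c ≡ guesses v x c'
  guesses-local zero    x c c' agree = cong (guessesA x) (agree (suc B) A∼B)
  guesses-local (suc u) x c c' agree =
    trans same-hint (local S u (hintB c') (c ∘ suc) (c' ∘ suc) (λ v → agree (suc v)))
    where
    same-hint : guess S u (hintB c) (c ∘ suc) ≡ guess S u (hintB c') (c ∘ suc)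
    same-hint with u ≟ B
    ... | yes refl = cong (λ a → guess S u ((toℕ a * wB) mod hB) (c ∘ suc)) (agree zero A∼B)
      where instance _ = nonZeroIndex (c (suc B))
    ... | no  u≢B  = hintOnlyB S u u≢B (hintB c) (hintB c') (c ∘ suc)

  guesses-hintOnlyA : ∀ v → ¬ (v ≡ zero) → ∀ x x' (c : Coloring h) → guesses v x c ≡ guesses v x' c
  guesses-hintOnlyA zero    v≢A = contradiction refl v≢A
  guesses-hintOnlyA (suc u) _ x x' c = refl

  strategy : g zero ≤ wA → (wA ∸ g zero) * hB ≤ wA * wB → HintStrategy (addPendant G B) h g zero
  strategy gA≤wA few-misses = record
    { guess     = guesses
    ; local     = guesses-local
    ; hintOnlyB = guesses-hintOnlyA
    ; bounded   = λ where
        zero    x c → length-guessesA≤ x (c (suc B))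
        (suc u) x c → bounded S u (hintB c) (c ∘ suc)
    }
    where
    length-guessesA≤ : ∀ x b → length (guessesA x b) ≤ g zero
    length-guessesA≤ x b = begin
      length (guessesA x b)                                       ≡⟨ length-map _ (missedBlocks wA (toℕ x) _) ⟩
      length (missedBlocks wA (toℕ x) (offset (toℕ b) (toℕ x)))   ≤⟨ length-missedBlocks≤ (toℕ x) (offset<h (toℕ b) (toℕ x)) gA≤wA few-misses ⟩
      g zero                                                      ∎
      where
      open ≤-Reasoning
      instance _ = nonZeroIndex b

  hintB-congruent : hB ∣ wB * hA → ∀ (c : Coloring h) {j k} e → j ≡ toℕ (c zero) + k * hA →
                    let instance _ = nonZeroIndex (c (suc B)) in (toℕ (hintB c) + e) % hB ≡ (j * wB + e) % hB
  hintB-congruent hB∣wB*hA c {j} {k} e j≡cA+k*hA = begin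
    (toℕ (hintB c) + e) % hB              ≡⟨ cong (λ z → (z + e) % hB) (toℕ-fromℕ< _) ⟩
    ((toℕ (c zero) * wB) % hB + e) % hB   ≡⟨ [m%n+k]%n≡[m+k]%n (toℕ (c zero) * wB) e hB ⟩
    (toℕ (c zero) * wB + e) % hB          ≡⟨ [m*w+e]%d≡[n*w+e]%d {k = k} e hB∣wB*hA j≡cA+k*hA ⟨
    (j * wB + e) % hB                     ∎
    where
    open ≡-Reasoning
    instance _ = nonZeroIndex (c (suc B))

  guesses-win : hB ∣ wB * hA →
                (∀ (c : Coloring (h ∘ suc)) y → Admissible (h ∘ suc) B wB c y → ∃[ v ] (c v ∈ guess S v y c)) →
                ∀ (c : Coloring h) x → Admissible h zero wA c x → ∃[ v ] (c v ∈ guesses v x c)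
  guesses-win hB∣wB*hA S-wins c x (i , k , i<wA , x+i≡cA+k*hA)
    with hit⊎missed {{nonZeroIndex b}} (toℕ b) wA (toℕ x) _ (offset-correct {{nonZeroIndex b}} (toℕ b) (toℕ x))
                    (m≤m+n (toℕ x) i) (+-monoʳ-< (toℕ x) i<wA)
    where b = c (suc B)
  ... | inj₂ missed =
    zero , subst (_∈ guesses zero x c) (n≡y+km⇒n-mod-m≡y {k = k} (c zero) x+i≡cA+k*hA) (∈-map⁺ _ missed)
  ... | inj₁ (e , e<wB , hit) =
    let hint-admissible = admissible-% {h = h ∘ suc} {B} {c = c ∘ suc} e<wB
                            (trans (hintB-congruent hB∣wB*hA c {k = k} e x+i≡cA+k*hA) hit)
        v , cv∈guesses = S-wins (c ∘ suc) (hintB c) hint-admissible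
    in suc v , cv∈guesses
    where instance _ = nonZeroIndex (c (suc B))

theorem2p12 : {n : ℕ} (G : Graph n) (B : Fin n) (h̃ g̃ : Fin (suc n) → ℕ) (wA wB : ℕ) →
    g̃ zero ≤ wA → wA ≤ h̃ zero →
    g̃ (suc B) ≤ wB → wB ≤ h̃ (suc B) →
    WinningWithHint G (h̃ ∘ suc) (g̃ ∘ suc) B wB →
    h̃ (suc B) ∣ wB * h̃ zero →
    (wA ∸ g̃ zero) * h̃ (suc B) ≤ wA * wB →
    WinningWithHint (addPendant G B) h̃ g̃ zero wA
theorem2p12 G B h̃ g̃ wA wB gA≤wA _ _ wB≤hB (S , S-wins) hB∣wB*hA few-misses =
  strategy gA≤wA few-misses , guesses-win hB∣wB*hA S-wins
  where open PendantStrategy G B h̃ g̃ wA wB wB≤hB S
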